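{- The approximation ratio of the Greedy algorithm for the triangle scheduling problem is at least $1.05$; i.e., there exists an instance on which the makespan of the Greedy schedule is at least $1.05$ times the optimal makespan.
   Context: Triangle scheduling problem (TS): given integers $p_1\ge \dots\ge p_n>0$, a feasible schedule is a choice of starting times $s_1,\dots,s_n\ge 0$ such that for all $i\ne j$, $|s_i-s_j|\ge \min\{p_i,p_j\}$; its makespan is $\max_j (s_j+p_j)$, and the optimal makespan is the minimum over feasible schedules. For a (partial) schedule, a gap is any interval between two successive starting times, together with the interval from the largest starting time to the makespan. Greedy algorithm: set $s_1=0$. Then for $j=2,\dots,n$ in order, choose a gap of largest length among the current gaps (the first one, i.e. leftmost, in case of ties); if this gap has length $x$ and starts at time $s_i$, set $s_j=s_i+p_j$; if $2p_j>x$, then every already placed job $k$ with $s_k>s_j$ is delayed by $2p_j-x$. -}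

module Defs where

open import Data.Nat using (ℕ; zero; suc; _+_; _*_; _∸_; _⊔_; _⊓_; _≤_; _<_; _≥_; _<ᵇ_; _≡ᵇ_; ∣_-_∣)
open import Data.Bool using (Bool; true; false; if_then_else_; _∨_; _∧_)
open import Data.Maybe using (Maybe; just; nothing; maybe)
open import Data.Product using (_×_; _,_; proj₁; proj₂)
open import Data.List using (List; []; _∷_; _++_; map; foldr; foldl; length; lookup; allFin)
open import Data.Fin using (Fin)
open import Relation.Binary.PropositionalEquality using (_≢_)

-- Partial schedules built by Greedy: list of placed jobs (start , p),
-- in job order.

Placed : Set
Placed = List (ℕ × ℕ)

makespanP : Placed → ℕ
makespanP = foldr (λ sp m → (proj₁ sp + proj₂ sp) ⊔ m) 0

nextStart : ℕ → Placed → Maybe ℕ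
nextStart s [] = nothing
nextStart s ((t , _) ∷ rest) with s <ᵇ t | nextStart s rest
... | false | r = r
... | true  | nothing = just t
... | true  | just u = just (t ⊓ u)

gapLen : ℕ → Placed → ℕ
gapLen s sch = maybe (λ u → u) (makespanP sch) (nextStart s sch) ∸ s

better : ℕ × ℕ → ℕ × ℕ → ℕ × ℕ
better (s , x) (s' , x') =
  if (x <ᵇ x') ∨ ((x ≡ᵇ x') ∧ (s' <ᵇ s)) then (s' , x') else (s , x)

pickGap : ℕ × ℕ → List (ℕ × ℕ) → ℕ × ℕ
pickGap = foldl better

largestGap : Placed → ℕ × ℕ
largestGap sch with map (λ sp → (proj₁ sp , gapLen (proj₁ sp) sch)) sch
... | [] = (0 , 0)
... | g ∷ gs = pickGap g gs

greedyStep : Placed → ℕ → Placed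
greedyStep sch p =
  let g  = largestGap sch
      sj = proj₁ g + p
      d  = (2 * p) ∸ proj₂ g
  in map (λ sp → if proj₁ g <ᵇ proj₁ sp then (proj₁ sp + d , proj₂ sp) else sp) sch
     ++ ((sj , p) ∷ [])

greedy : List ℕ → Placed
greedy [] = []
greedy (p ∷ ps) = foldl greedyStep ((0 , p) ∷ []) ps

greedyMakespan : List ℕ → ℕ
greedyMakespan ps = makespanP (greedy ps)

Schedule : List ℕ → Set
Schedule ps = Fin (length ps) → ℕ

Feasible : (ps : List ℕ) → Schedule ps → Set
Feasible ps s = ∀ i j → i ≢ j → (lookup ps i ⊓ lookup ps j) ≤ ∣ s i - s j ∣

makespan : (ps : List ℕ) → Schedule ps → ℕ
makespan ps s = foldr (λ i m → (s i + lookup ps i) ⊔ m) 0 (allFin (length ps))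

module Submission where

open import Defs
open import Data.Nat using (ℕ; _*_; _≤_; _≥_; _<_; _≤?_; _≥?_; _<?_; _⊓_; ∣_-_∣)
open import Data.Fin using (zero; suc; _≟_)
open import Data.Fin.Properties using (all?)
open import Data.List using (List; []; _∷_; lookup)
open import Data.List.Relation.Unary.All using (All)
import Data.List.Relation.Unary.All as All
open import Data.List.Relation.Unary.Linked using (Linked; linked?)
open import Data.Product using (_×_; ∃-syntax; _,_)
open import Relation.Nullary.Decidable using (Dec; from-yes; ¬?; _→-dec_)
open import Relation.Binary.PropositionalEquality using (_≡_; _≢_; refl)

feasible? : (ps : List ℕ) (s : Schedule ps) → Dec (Feasible ps s)
feasible? ps s = all? λ i → all? λ j →
  ¬? (i ≟ j) →-dec (lookup ps i ⊓ lookup ps j ≤? ∣ s i - s j ∣)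

-- Greedy starts the jobs at 0, 10, 17, 24, 2: the jobs of length 10, 7, 7 go
-- back to back from time 10 and the last one ends at 31. Nesting both jobs of
-- length 7 under the first job instead keeps everything within its length 28.
instance₀ : List ℕ
instance₀ = 28 ∷ 10 ∷ 7 ∷ 7 ∷ 2 ∷ []

schedule₀ : Schedule instance₀
schedule₀ zero                         = 0
schedule₀ (suc zero)                   = 14
schedule₀ (suc (suc zero))             = 7
schedule₀ (suc (suc (suc zero)))       = 21
schedule₀ (suc (suc (suc (suc zero)))) = 23

schedule₀-feasible : Feasible instance₀ schedule₀
schedule₀-feasible = from-yes (feasible? instance₀ schedule₀)

makespan-schedule₀ : makespan instance₀ schedule₀ ≡ 28
makespan-schedule₀ = refl

greedyMakespan-instance₀ : greedyMakespan instance₀ ≡ 31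
greedyMakespan-instance₀ = refl

mainTheorem3 : ∃[ ps ] (ps ≢ [] × Linked _≥_ ps × All (λ p → 0 < p) ps
    × ∃[ s ] (Feasible ps s × 21 * makespan ps s ≤ 20 * greedyMakespan ps))
mainTheorem3 =
  instance₀ , (λ ()) , from-yes (linked? _≥?_ instance₀) , from-yes (All.all? (0 <?_) instance₀) ,
  schedule₀ , schedule₀-feasible , ratio
  where
  ratio : 21 * makespan instance₀ schedule₀ ≤ 20 * greedyMakespan instance₀
  ratio rewrite makespan-schedule₀ | greedyMakespan-instance₀ = from-yes (21 * 28 ≤? 20 * 31)
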